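{- Let $\mathbb{M}\in\{\mathsf K,\mathsf D,\mathsf T,\mathsf{K4},\mathsf{S4}\}$. If the 2-sequent $\vdash A^{\langle\,\rangle}$ is provable in $2_{\mathbb M}$, then so is $\vdash(\Box A)^{\langle\,\rangle}$.
   Context: Modal formulas over proposition symbols with $\neg,\wedge,\vee,\to,\Box,\Diamond$. Fix a countably infinite set of tokens; a position is a finite (possibly empty) sequence of tokens, $\langle\,\rangle$ the empty one, $\circ$ concatenation, $\alpha\circ x=\alpha\circ\langle x\rangle$, $\beta\preceq\alpha$ means $\beta$ is a prefix of $\alpha$. A p-formula is $A^\alpha$; a 2-sequent is $\Gamma\vdash\Delta$ with $\Gamma,\Delta$ finite (possibly empty) sequences of p-formulas; $I(\Gamma)=\{\beta:\exists A^\alpha\in\Gamma,\ \beta\preceq\alpha\}$. Calculus $2_{\mathsf{S4}}$: Axiom $A^\alpha\vdash A^\alpha$; Cut: from $\Gamma_1\vdash A^\alpha,\Delta_1$ and $\Gamma_2,A^\alpha\vdash\Delta_2$ infer $\Gamma_1,\Gamma_2\vdash\Delta_1,\Delta_2$; weakening, contraction, exchange; classical propositional sequent rules for $\neg,\wedge,\vee,\to$ with all active p-formulas at the same position; modal rules: ($\Box\vdash$) from $\Gamma,A^{\alpha\circ\beta}\vdash\Delta$ infer $\Gamma,(\Box A)^\alpha\vdash\Delta$; ($\vdash\Box$) from $\Gamma\vdash A^{\alpha\circ x},\Delta$ infer $\Gamma\vdash(\Box A)^\alpha,\Delta$; ($\Diamond\vdash$) from $\Gamma,A^{\alpha\circ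 x}\vdash\Delta$ infer $\Gamma,(\Diamond A)^\alpha\vdash\Delta$; ($\vdash\Diamond$) from $\Gamma\vdash A^{\alpha\circ\beta},\Delta$ infer $\Gamma\vdash(\Diamond A)^\alpha,\Delta$; $\beta$ a position, $x$ a token, and in $\vdash\Box,\Diamond\vdash$, $\alpha\circ x\notin I(\Gamma,\Delta)$. $2_{\mathsf T},2_{\mathsf D},2_{\mathsf{K4}},2_{\mathsf K}$ add constraints on $\Box\vdash,\vdash\Diamond$: $2_{\mathsf T}$: $\beta$ empty or a single token; $2_{\mathsf D}$: $\beta$ a single token; $2_{\mathsf{K4}}$: $\beta$ nonempty and $\Gamma$ or $\Delta$ contains some $B^{\alpha\circ\beta\circ\eta}$; $2_{\mathsf K}$: $\beta$ a single token and $\Gamma$ or $\Delta$ contains some $B^{\alpha\circ\beta\circ\eta}$. In $2_{\mathsf K},2_{\mathsf{K4}}$ Cut requires $\alpha\in I(\Gamma_1,\Delta_1)$ or $\alpha\in I(\Gamma_2,\Delta_2)$. -}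

module Defs where

open import Data.Nat using (ℕ)
open import Data.List using (List; []; _∷_; _++_; [_])
open import Data.List.Relation.Unary.Any using (Any)
open import Data.List.Relation.Binary.Permutation.Propositional using (_↭_)
open import Data.Product using (Σ; ∃; _×_; _,_)
open import Data.Sum using (_⊎_)
open import Data.Unit using (⊤)
open import Relation.Nullary using (¬_)
open import Relation.Binary.PropositionalEquality using (_≡_; _≢_)

data Formula : Set where
  var  : ℕ → Formula
  ¬'_  : Formula → Formula
  _∧'_ : Formula → Formula → Formula
  _∨'_ : Formula → Formula → Formula
  _⇒'_ : Formula → Formula → Formula
  □_   : Formula → Formula
  ◇_   : Formula → Formula

Token : Set
Token = ℕ

-- Positions: finite sequences of tokens; ⟨⟩ = [], concatenation = _++_.
Position : Set
Position = List Token

_⪯_ : Position → Position → Set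
β ⪯ α = ∃ λ γ → β ++ γ ≡ α

record PFormula : Set where
  constructor _^_
  field
    formula  : Formula
    position : Position
open PFormula public

_∈I_ : Position → List PFormula → Set
β ∈I Γ = Any (λ P → β ⪯ position P) Γ

data Logic : Set where
  K D T K4 S4 : Logic

Reaches : Position → List PFormula → List PFormula → Set
Reaches αβ Γ Δ = Any (λ P → αβ ⪯ position P) (Γ ++ Δ)

ModalOK : Logic → Position → Position → List PFormula → List PFormula → Set
ModalOK S4 α β Γ Δ = ⊤
ModalOK T  α β Γ Δ = (β ≡ []) ⊎ (∃ λ x → β ≡ [ x ])
ModalOK D  α β Γ Δ = ∃ λ x → β ≡ [ x ]
ModalOK K4 α β Γ Δ = (β ≢ []) × Reaches (α ++ β) Γ Δ
ModalOK K  α β Γ Δ = (∃ λ x → β ≡ [ x ]) × Reaches (α ++ β) Γ Δ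

CutOK : Logic → Position → List PFormula → List PFormula →
        List PFormula → List PFormula → Set
CutOK K  α Γ₁ Δ₁ Γ₂ Δ₂ = (α ∈I (Γ₁ ++ Δ₁)) ⊎ (α ∈I (Γ₂ ++ Δ₂))
CutOK K4 α Γ₁ Δ₁ Γ₂ Δ₂ = (α ∈I (Γ₁ ++ Δ₁)) ⊎ (α ∈I (Γ₂ ++ Δ₂))
CutOK D  α Γ₁ Δ₁ Γ₂ Δ₂ = ⊤
CutOK T  α Γ₁ Δ₁ Γ₂ Δ₂ = ⊤
CutOK S4 α Γ₁ Δ₁ Γ₂ Δ₂ = ⊤

Fresh : Position → Token → List PFormula → List PFormula → Set
Fresh α x Γ Δ = ¬ ((α ++ [ x ]) ∈I (Γ ++ Δ))

-- Derivability of the 2-sequent Γ ⊢ Δ in 2_M.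
-- "Γ , A" is written Γ ++ [ A ], "A , Δ" is written A ∷ Δ.
data _⊩_⊢_ (M : Logic) : List PFormula → List PFormula → Set where
  ax   : ∀ {P} → M ⊩ [ P ] ⊢ [ P ]
  cut  : ∀ {Γ₁ Δ₁ Γ₂ Δ₂ A α} →
         M ⊩ Γ₁ ⊢ ((A ^ α) ∷ Δ₁) → M ⊩ (Γ₂ ++ [ A ^ α ]) ⊢ Δ₂ →
         CutOK M α Γ₁ Δ₁ Γ₂ Δ₂ →
         M ⊩ (Γ₁ ++ Γ₂) ⊢ (Δ₁ ++ Δ₂)
  wL   : ∀ {Γ Δ P} → M ⊩ Γ ⊢ Δ → M ⊩ (Γ ++ [ P ]) ⊢ Δ
  wR   : ∀ {Γ Δ P} → M ⊩ Γ ⊢ Δ → M ⊩ Γ ⊢ (P ∷ Δ)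
  cL   : ∀ {Γ Δ P} → M ⊩ (Γ ++ P ∷ P ∷ []) ⊢ Δ → M ⊩ (Γ ++ [ P ]) ⊢ Δ
  cR   : ∀ {Γ Δ P} → M ⊩ Γ ⊢ (P ∷ P ∷ Δ) → M ⊩ Γ ⊢ (P ∷ Δ)
  exL  : ∀ {Γ Γ' Δ} → Γ ↭ Γ' → M ⊩ Γ ⊢ Δ → M ⊩ Γ' ⊢ Δ
  exR  : ∀ {Γ Δ Δ'} → Δ ↭ Δ' → M ⊩ Γ ⊢ Δ → M ⊩ Γ ⊢ Δ'
  ¬L   : ∀ {Γ Δ A α} → M ⊩ Γ ⊢ ((A ^ α) ∷ Δ) → M ⊩ (Γ ++ [ (¬' A) ^ α ]) ⊢ Δ
  ¬R   : ∀ {Γ Δ A α} → M ⊩ (Γ ++ [ A ^ α ]) ⊢ Δ → M ⊩ Γ ⊢ (((¬' A) ^ α) ∷ Δ)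
  ∧L₁  : ∀ {Γ Δ A B α} → M ⊩ (Γ ++ [ A ^ α ]) ⊢ Δ → M ⊩ (Γ ++ [ (A ∧' B) ^ α ]) ⊢ Δ
  ∧L₂  : ∀ {Γ Δ A B α} → M ⊩ (Γ ++ [ B ^ α ]) ⊢ Δ → M ⊩ (Γ ++ [ (A ∧' B) ^ α ]) ⊢ Δ
  ∧R   : ∀ {Γ Δ A B α} → M ⊩ Γ ⊢ ((A ^ α) ∷ Δ) → M ⊩ Γ ⊢ ((B ^ α) ∷ Δ) →
         M ⊩ Γ ⊢ (((A ∧' B) ^ α) ∷ Δ)
  ∨L   : ∀ {Γ Δ A B α} → M ⊩ (Γ ++ [ A ^ α ]) ⊢ Δ → M ⊩ (Γ ++ [ B ^ α ]) ⊢ Δ →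
         M ⊩ (Γ ++ [ (A ∨' B) ^ α ]) ⊢ Δ
  ∨R₁  : ∀ {Γ Δ A B α} → M ⊩ Γ ⊢ ((A ^ α) ∷ Δ) → M ⊩ Γ ⊢ (((A ∨' B) ^ α) ∷ Δ)
  ∨R₂  : ∀ {Γ Δ A B α} → M ⊩ Γ ⊢ ((B ^ α) ∷ Δ) → M ⊩ Γ ⊢ (((A ∨' B) ^ α) ∷ Δ)
  ⇒L   : ∀ {Γ Δ A B α} → M ⊩ Γ ⊢ ((A ^ α) ∷ Δ) → M ⊩ (Γ ++ [ B ^ α ]) ⊢ Δ →
         M ⊩ (Γ ++ [ (A ⇒' B) ^ α ]) ⊢ Δ
  ⇒R   : ∀ {Γ Δ A B α} → M ⊩ (Γ ++ [ A ^ α ]) ⊢ ((B ^ α) ∷ Δ) →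
         M ⊩ Γ ⊢ (((A ⇒' B) ^ α) ∷ Δ)
  □L   : ∀ {Γ Δ A α β} → ModalOK M α β Γ Δ →
         M ⊩ (Γ ++ [ A ^ (α ++ β) ]) ⊢ Δ → M ⊩ (Γ ++ [ (□ A) ^ α ]) ⊢ Δ
  □R   : ∀ {Γ Δ A α x} → Fresh α x Γ Δ →
         M ⊩ Γ ⊢ ((A ^ (α ++ [ x ])) ∷ Δ) → M ⊩ Γ ⊢ (((□ A) ^ α) ∷ Δ)
  ◇L   : ∀ {Γ Δ A α x} → Fresh α x Γ Δ →
         M ⊩ (Γ ++ [ A ^ (α ++ [ x ]) ]) ⊢ Δ → M ⊩ (Γ ++ [ (◇ A) ^ α ]) ⊢ Δ
  ◇R   : ∀ {Γ Δ A α β} → ModalOK M α β Γ Δ →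
         M ⊩ Γ ⊢ ((A ^ (α ++ β)) ∷ Δ) → M ⊩ Γ ⊢ (((◇ A) ^ α) ∷ Δ)

-- Prefixing every position of a derivation by a fixed position γ yields again a
-- derivation: the side conditions of all rules only compare positions by the
-- prefix order and the sets I(Γ), and both are invariant under γ ++_.  Shifting a
-- proof of ⊢ A^⟨⟩ by ⟨x⟩ gives ⊢ A^⟨x⟩, where x is trivially fresh for the empty
-- context, so one application of (⊢□) gives ⊢ (□A)^⟨⟩.
module Submission where

open import Defs
open import Data.List using (List; []; _∷_; _++_; [_]; map)
open import Data.List.Properties using (map-++; ++-assoc; ++-cancelˡ)
open import Data.List.Relation.Unary.Any using (Any)
import Data.List.Relation.Unary.Any as Any
open import Data.List.Relation.Unary.Any.Properties using (map⁺; map⁻)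
import Data.List.Relation.Binary.Permutation.Propositional.Properties as Perm
open import Data.Product using (_,_)
open import Data.Sum using (inj₁; inj₂)
open import Relation.Binary.PropositionalEquality
  using (_≡_; refl; sym; trans; cong; subst)

substˡ : ∀ {M Γ Γ' Δ} → Γ ≡ Γ' → M ⊩ Γ ⊢ Δ → M ⊩ Γ' ⊢ Δ
substˡ refl d = d

substʳ : ∀ {M Γ Δ Δ'} → Δ ≡ Δ' → M ⊩ Γ ⊢ Δ → M ⊩ Γ ⊢ Δ'
substʳ refl d = d

⪯-++⁺ : ∀ γ {β α} → β ⪯ α → (γ ++ β) ⪯ (γ ++ α)
⪯-++⁺ γ {β} (η , eq) = η , trans (++-assoc γ β η) (cong (γ ++_) eq)

⪯-++⁻ : ∀ γ {β α} → (γ ++ β) ⪯ (γ ++ α) → β ⪯ α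
⪯-++⁻ γ {β} {α} (η , eq) = η , ++-cancelˡ γ (β ++ η) α (trans (sym (++-assoc γ β η)) eq)

shift : Position → PFormula → PFormula
shift γ (A ^ α) = A ^ (γ ++ α)

shiftAll : Position → List PFormula → List PFormula
shiftAll γ = map (shift γ)

shiftAll-++ : ∀ γ Γ Δ → shiftAll γ (Γ ++ Δ) ≡ shiftAll γ Γ ++ shiftAll γ Δ
shiftAll-++ γ = map-++ (shift γ)

shift-++ : ∀ γ A α β → shift γ (A ^ (α ++ β)) ≡ A ^ ((γ ++ α) ++ β)
shift-++ γ A α β = cong (A ^_) (sym (++-assoc γ α β))

shiftAll-snoc-++ : ∀ γ Γ A α β →
  shiftAll γ (Γ ++ [ A ^ (α ++ β) ]) ≡ shiftAll γ Γ ++ [ A ^ ((γ ++ α) ++ β) ]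
shiftAll-snoc-++ γ Γ A α β =
  trans (shiftAll-++ γ Γ _) (cong (λ P → shiftAll γ Γ ++ [ P ]) (shift-++ γ A α β))

prefixed-shift⁺ : ∀ γ β Γ Δ →
  Any (λ P → β ⪯ position P) (Γ ++ Δ) →
  Any (λ P → (γ ++ β) ⪯ position P) (shiftAll γ Γ ++ shiftAll γ Δ)
prefixed-shift⁺ γ β Γ Δ h =
  subst (Any _) (shiftAll-++ γ Γ Δ) (map⁺ (Any.map (λ {P} → shifted P) h))
  where
  shifted : ∀ P → β ⪯ position P → (γ ++ β) ⪯ position (shift γ P)
  shifted (A ^ α) = ⪯-++⁺ γ

prefixed-shift⁻ : ∀ γ β Γ Δ →
  Any (λ P → (γ ++ β) ⪯ position P) (shiftAll γ Γ ++ shiftAll γ Δ) →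
  Any (λ P → β ⪯ position P) (Γ ++ Δ)
prefixed-shift⁻ γ β Γ Δ h =
  Any.map (λ {P} → unshifted P) (map⁻ (subst (Any _) (sym (shiftAll-++ γ Γ Δ)) h))
  where
  unshifted : ∀ P → (γ ++ β) ⪯ position (shift γ P) → β ⪯ position P
  unshifted (A ^ α) = ⪯-++⁻ γ

Reaches-shift : ∀ γ α β Γ Δ → Reaches (α ++ β) Γ Δ →
  Reaches ((γ ++ α) ++ β) (shiftAll γ Γ) (shiftAll γ Δ)
Reaches-shift γ α β Γ Δ r =
  subst (λ p → Any (λ P → p ⪯ position P) _) (sym (++-assoc γ α β))
        (prefixed-shift⁺ γ (α ++ β) Γ Δ r)

Fresh-shift : ∀ γ α x Γ Δ → Fresh α x Γ Δ → Fresh (γ ++ α) x (shiftAll γ Γ) (shiftAll γ Δ)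
Fresh-shift γ α x Γ Δ fresh h =
  fresh (prefixed-shift⁻ γ (α ++ [ x ]) Γ Δ
          (subst (λ p → Any (λ P → p ⪯ position P) _) (++-assoc γ α [ x ]) h))

ModalOK-shift : ∀ M γ α β Γ Δ → ModalOK M α β Γ Δ →
  ModalOK M (γ ++ α) β (shiftAll γ Γ) (shiftAll γ Δ)
ModalOK-shift K  γ α β Γ Δ (step , r) = step , Reaches-shift γ α β Γ Δ r
ModalOK-shift D  γ α β Γ Δ ok = ok
ModalOK-shift T  γ α β Γ Δ ok = ok
ModalOK-shift K4 γ α β Γ Δ (β≢[] , r) = β≢[] , Reaches-shift γ α β Γ Δ r
ModalOK-shift S4 γ α β Γ Δ ok = ok

CutOK-shift : ∀ M γ α Γ₁ Δ₁ Γ₂ Δ₂ → CutOK M α Γ₁ Δ₁ Γ₂ Δ₂ →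
  CutOK M (γ ++ α) (shiftAll γ Γ₁) (shiftAll γ Δ₁) (shiftAll γ Γ₂) (shiftAll γ Δ₂)
CutOK-shift K  γ α Γ₁ Δ₁ Γ₂ Δ₂ (inj₁ h) = inj₁ (prefixed-shift⁺ γ α Γ₁ Δ₁ h)
CutOK-shift K  γ α Γ₁ Δ₁ Γ₂ Δ₂ (inj₂ h) = inj₂ (prefixed-shift⁺ γ α Γ₂ Δ₂ h)
CutOK-shift K4 γ α Γ₁ Δ₁ Γ₂ Δ₂ (inj₁ h) = inj₁ (prefixed-shift⁺ γ α Γ₁ Δ₁ h)
CutOK-shift K4 γ α Γ₁ Δ₁ Γ₂ Δ₂ (inj₂ h) = inj₂ (prefixed-shift⁺ γ α Γ₂ Δ₂ h)
CutOK-shift D  γ α Γ₁ Δ₁ Γ₂ Δ₂ ok = ok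
CutOK-shift T  γ α Γ₁ Δ₁ Γ₂ Δ₂ ok = ok
CutOK-shift S4 γ α Γ₁ Δ₁ Γ₂ Δ₂ ok = ok

⊩-shift : ∀ {M Γ Δ} γ → M ⊩ Γ ⊢ Δ → M ⊩ shiftAll γ Γ ⊢ shiftAll γ Δ
⊩-shift {M} γ = go
  where
  snoc : ∀ Γ P → shiftAll γ (Γ ++ [ P ]) ≡ shiftAll γ Γ ++ [ shift γ P ]
  snoc Γ P = shiftAll-++ γ Γ [ P ]

  onLast : ∀ {Γ Δ P} → M ⊩ shiftAll γ Γ ++ [ shift γ P ] ⊢ Δ → M ⊩ shiftAll γ (Γ ++ [ P ]) ⊢ Δ
  onLast {Γ} {P = P} = substˡ (sym (snoc Γ P))

  go : ∀ {Γ Δ} → M ⊩ Γ ⊢ Δ → M ⊩ shiftAll γ Γ ⊢ shiftAll γ Δ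
  go ax = ax
  go (cut {Γ₁} {Δ₁} {Γ₂} {Δ₂} {A} {α} d e ok) =
    substˡ (sym (shiftAll-++ γ Γ₁ Γ₂)) (substʳ (sym (shiftAll-++ γ Δ₁ Δ₂))
      (cut (go d) (substˡ (snoc Γ₂ _) (go e)) (CutOK-shift M γ α Γ₁ Δ₁ Γ₂ Δ₂ ok)))
  go (wL d) = onLast (wL (go d))
  go (wR d) = wR (go d)
  go (cL {Γ} {P = P} d) = onLast (cL (substˡ (shiftAll-++ γ Γ (P ∷ P ∷ [])) (go d)))
  go (cR d) = cR (go d)
  go (exL p d) = exL (Perm.map⁺ (shift γ) p) (go d)
  go (exR p d) = exR (Perm.map⁺ (shift γ) p) (go d)
  go (¬L d) = onLast (¬L (go d))
  go (¬R {Γ} d) = ¬R (substˡ (snoc Γ _) (go d))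
  go (∧L₁ {Γ} d) = onLast (∧L₁ (substˡ (snoc Γ _) (go d)))
  go (∧L₂ {Γ} d) = onLast (∧L₂ (substˡ (snoc Γ _) (go d)))
  go (∧R d e) = ∧R (go d) (go e)
  go (∨L {Γ} d e) = onLast (∨L (substˡ (snoc Γ _) (go d)) (substˡ (snoc Γ _) (go e)))
  go (∨R₁ d) = ∨R₁ (go d)
  go (∨R₂ d) = ∨R₂ (go d)
  go (⇒L {Γ} d e) = onLast (⇒L (go d) (substˡ (snoc Γ _) (go e)))
  go (⇒R {Γ} d) = ⇒R (substˡ (snoc Γ _) (go d))
  go (□L {Γ} {Δ} {A} {α} {β} ok d) =
    onLast (□L (ModalOK-shift M γ α β Γ Δ ok) (substˡ (shiftAll-snoc-++ γ Γ A α β) (go d)))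
  go (□R {Γ} {Δ} {A} {α} {x} fresh d) =
    □R (Fresh-shift γ α x Γ Δ fresh) (substʳ (cong (_∷ _) (shift-++ γ A α [ x ])) (go d))
  go (◇L {Γ} {Δ} {A} {α} {x} fresh d) =
    onLast (◇L (Fresh-shift γ α x Γ Δ fresh) (substˡ (shiftAll-snoc-++ γ Γ A α [ x ]) (go d)))
  go (◇R {Γ} {Δ} {A} {α} {β} ok d) =
    ◇R (ModalOK-shift M γ α β Γ Δ ok) (substʳ (cong (_∷ _) (shift-++ γ A α β)) (go d))

mainTheorem10 : (M : Logic) (A : Formula) →
    M ⊩ [] ⊢ [ A ^ [] ] → M ⊩ [] ⊢ [ (□ A) ^ [] ]
mainTheorem10 M A d = □R {x = 0} (λ ()) (⊩-shift [ 0 ] d)
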